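{- Let $h(x)$ be a polynomial with real coefficients and let $L_{h,n}(x)$ be defined by $L_{h,0}=2$, $L_{h,1}=h(x)$, $L_{h,n+1}=h(x)L_{h,n}+L_{h,n-1}$ ($n\ge1$). Fix an integer $l\ge1$ and set $L_{h,n}^l(x)=\sum_{i=0}^{l}\frac{n}{n-i}\binom{n-i}{i}h^{n-2i}(x)$ for $n\ge 2l$ and $L_{h,n}^l(x)=0$ for $0\le n<2l$. Then, as formal power series in $t$, $$\sum_{i=0}^{\infty}L_{h,i}^{l}(x)\,t^{i}=\frac{t^{2l}\left[L_{h,2l}(x)+\big(L_{h,2l+1}(x)-h(x)L_{h,2l}(x)\big)t-\dfrac{t^{2}\,(2-h(x)t)}{(1-h(x)t)^{l+1}}\right]}{1-h(x)t-t^{2}}.$$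
   Context: $h(x)$ is a polynomial with real coefficients. $L_{h,n}$ are the $h(x)$-Lucas polynomials and $L^l_{h,n}$ the incomplete $h(x)$-Lucas polynomials (extended by $0$ for $n<2l$). -}

module Defs where

open import Level using (Level)
open import Algebra.Bundles using (CommutativeRing)
open import Data.Nat as ℕ using (ℕ; zero; suc; _∸_; _≤?_)
open import Data.Nat.DivMod using (_/_)
open import Data.Nat.Combinatorics using (_C_)
open import Data.Fin using (Fin; toℕ)
open import Data.Vec using (Vec; []; _∷_; head; lookup)
open import Relation.Nullary using (yes; no)

-- Exact division of naturals (used only where the quotient is exact;
-- returns 0 on division by zero, which never occurs in our use).
_div_ : ℕ → ℕ → ℕ
a div zero = 0
a div suc k = a / suc k

module Lucas {c ℓ : Level} (R : CommutativeRing c ℓ) where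
  open CommutativeRing R

  ⟦_⟧ : ℕ → Carrier
  ⟦ zero ⟧ = 0#
  ⟦ suc n ⟧ = 1# + ⟦ n ⟧

  _^_ : Carrier → ℕ → Carrier
  x ^ zero = 1#
  x ^ suc n = x * (x ^ n)

  ΣFin : (n : ℕ) → (Fin n → Carrier) → Carrier
  ΣFin zero f = 0#
  ΣFin (suc n) f = f Data.Fin.zero + ΣFin n (λ j → f (Data.Fin.suc j))

  Σ≤ : ℕ → (ℕ → Carrier) → Carrier
  Σ≤ m f = ΣFin (suc m) (λ j → f (toℕ j))

  L : Carrier → ℕ → Carrier
  L h zero = 1# + 1#
  L h (suc zero) = h
  L h (suc (suc n)) = h * L h (suc n) + L h n

  Linc : Carrier → ℕ → ℕ → Carrier
  Linc h l n with 2 ℕ.* l ≤? n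
  ... | yes _ = Σ≤ l (λ i → ⟦ (n ℕ.* ((n ∸ i) C i)) div (n ∸ i) ⟧ * (h ^ (n ∸ 2 ℕ.* i)))
  ... | no _ = 0#

  PS : Set c
  PS = ℕ → Carrier

  const : Carrier → PS
  const a zero = a
  const a (suc n) = 0#

  T : PS
  T zero = 0#
  T (suc zero) = 1#
  T (suc (suc n)) = 0#

  _⊕_ : PS → PS → PS
  (f ⊕ g) n = f n + g n

  ⊝_ : PS → PS
  (⊝ f) n = - f n

  _⊖_ : PS → PS → PS
  f ⊖ g = f ⊕ (⊝ g)

  _⊛_ : PS → PS → PS
  (f ⊛ g) n = Σ≤ n (λ k → f k * g (n ∸ k))

  _⊛^_ : PS → ℕ → PS
  f ⊛^ zero = const 1#
  f ⊛^ suc n = f ⊛ (f ⊛^ n)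

  -- first n+1 coefficients of the inverse of f, listed in reverse
  -- (valid when f 0 = 1): a_0 = 1, a_{m} = - sum_{k=1}^{m} f_k a_{m-k}
  invVec : PS → (n : ℕ) → Vec Carrier (suc n)
  invVec f zero = 1# ∷ []
  invVec f (suc n) =
    (- ΣFin (suc n) (λ j → f (suc (toℕ j)) * lookup v j)) ∷ v
    where v = invVec f n

  inv : PS → PS
  inv f n = head (invVec f n)

  _⊘_ : PS → PS → PS
  f ⊘ g = f ⊛ inv g

{-# OPTIONS --safe #-}
module Submission where

-- Put G(m) = L^l_{2l+m}, so that the left-hand side is t^{2l} G(t).  The coefficient
-- c(n,i) = n/(n-i)·C(n-i,i) equals C(n-i,i) + C(n-i-1,i-1), hence obeys Pascal's rule
-- c(n+2,i+1) = c(n+1,i+1) + c(n,i), and the partial sums S_l(n) = Σ_{i≤l} c(n,i) h^{n-2i}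
-- satisfy S_{l+1}(n+2) = h S_{l+1}(n+1) + S_l(n).  Thus G obeys the Lucas recurrence up to
-- the top term c(2l+m,l) h^m = (C(l+m,l) + C(l-1+m,l-1)) h^m, whose generating function is
-- (1-ht)^{-(l+1)} + (1-ht)^{-l} = (2-ht)/(1-ht)^{l+1}.  Multiplying G by 1 - ht - t² leaves
-- S_l(2l) = L_{2l} and S_l(2l+1) - h S_l(2l) = L_{2l+1} - h L_{2l} in degrees 0 and 1 (the
-- diagonal values follow from the same recurrence by induction on l), and minus t² times that
-- generating function in the higher degrees.

open import Defs
open import Algebra.Bundles using (CommutativeRing)
open import Data.Nat as N using (ℕ; zero; suc; _∸_; z≤n; s≤s; _≤?_)
import Data.Nat.Properties as N
open import Data.Nat.Combinatorics using (_C_; nCn≡1)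
open import Data.Fin using (Fin; toℕ; inject₁; fromℕ)
import Data.Fin as Fin
open import Data.Fin.Properties using (toℕ<n; toℕ-inject₁; toℕ-fromℕ; opposite-prop)
open import Data.Fin.Permutation using (reverse)
open import Data.Vec using (lookup)
open import Data.Product using (_×_; _,_; proj₁; proj₂)
open import Data.Empty using (⊥-elim)
open import Relation.Nullary using (yes; no)
open import Relation.Binary.PropositionalEquality as ≡ using (_≡_)

module LucasCoefficients where

  open import Data.Nat using (ℕ; zero; suc; _+_; _*_; _∸_; _<_; _≤_; z≤n; s≤s)
  open import Data.Nat.Properties
  open import Data.Nat.DivMod using (_/_; m*n/n≡m; n/n≡1)
  open import Data.Nat.Combinatorics using (_C_; nC1≡n; k>n⇒nCk≡0; nCk+nC[k+1]≡[n+1]C[k+1])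
  open import Data.Nat.Solver using (module +-*-Solver)
  open import Data.Product using (_,_)
  open import Relation.Binary.PropositionalEquality
  open ≡-Reasoning
  open +-*-Solver using (solve; _:=_; _:+_; _:*_; con)

  lucasCoeff : ℕ → ℕ → ℕ
  lucasCoeff n i = (n * ((n ∸ i) C i)) div (n ∸ i)

  [n+1]C[k+1]≡nCk+nC[k+1] : ∀ n k → suc n C suc k ≡ n C k + n C suc k
  [n+1]C[k+1]≡nCk+nC[k+1] n k = sym (nCk+nC[k+1]≡[n+1]C[k+1] n k)

  [i+1]*[k+1]C[i+1]≡[k+1]*kCi : ∀ k i → suc i * (suc k C suc i) ≡ suc k * (k C i)
  [i+1]*[k+1]C[i+1]≡[k+1]*kCi zero zero = refl
  [i+1]*[k+1]C[i+1]≡[k+1]*kCi zero (suc i) = begin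
    suc (suc i) * (1 C suc (suc i)) ≡⟨ cong (suc (suc i) *_) (k>n⇒nCk≡0 {1} {suc (suc i)} (s≤s (s≤s z≤n))) ⟩
    suc (suc i) * 0                 ≡⟨ *-zeroʳ (suc (suc i)) ⟩
    0                               ≡⟨ cong (1 *_) (k>n⇒nCk≡0 {0} {suc i} (s≤s z≤n)) ⟨
    1 * (0 C suc i)                 ∎
  [i+1]*[k+1]C[i+1]≡[k+1]*kCi (suc k) zero = begin
    1 * (suc (suc k) C 1) ≡⟨ *-identityˡ _ ⟩
    suc (suc k) C 1       ≡⟨ nC1≡n (suc (suc k)) ⟩
    suc (suc k)           ≡⟨ *-identityʳ _ ⟨
    suc (suc k) * 1       ∎
  [i+1]*[k+1]C[i+1]≡[k+1]*kCi (suc k) (suc i) = begin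
    suc (suc i) * (suc (suc k) C suc (suc i))
      ≡⟨ cong (suc (suc i) *_) ([n+1]C[k+1]≡nCk+nC[k+1] (suc k) (suc i)) ⟩
    suc (suc i) * (a + b)
      ≡⟨ solve 3 (λ i a b → (con 2 :+ i) :* (a :+ b) := a :+ (con 1 :+ i) :* a :+ (con 2 :+ i) :* b) refl i a b ⟩
    a + suc i * a + suc (suc i) * b
      ≡⟨ cong₂ (λ u v → a + u + v) ([i+1]*[k+1]C[i+1]≡[k+1]*kCi k i) ([i+1]*[k+1]C[i+1]≡[k+1]*kCi k (suc i)) ⟩
    a + suc k * x + suc k * y
      ≡⟨ cong (λ z → z + suc k * x + suc k * y) ([n+1]C[k+1]≡nCk+nC[k+1] k i) ⟩
    (x + y) + suc k * x + suc k * y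
      ≡⟨ solve 3 (λ k x y → (x :+ y) :+ (con 1 :+ k) :* x :+ (con 1 :+ k) :* y := (con 2 :+ k) :* (x :+ y)) refl k x y ⟩
    suc (suc k) * (x + y)
      ≡⟨ cong (suc (suc k) *_) ([n+1]C[k+1]≡nCk+nC[k+1] k i) ⟨
    suc (suc k) * (suc k C suc i) ∎
    where
    a = suc k C suc i
    b = suc k C suc (suc i)
    x = k C i
    y = k C suc i

  lucasCoeff-zero : ∀ n → lucasCoeff (suc n) 0 ≡ 1
  lucasCoeff-zero n = begin
    (suc n * 1) / suc n ≡⟨ cong (_/ suc n) (*-identityʳ (suc n)) ⟩
    suc n / suc n       ≡⟨ n/n≡1 (suc n) ⟩
    1                   ∎

  lucasCoeff-suc : ∀ i k → lucasCoeff (suc i + suc k) (suc i) ≡ suc k C suc i + k C i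
  lucasCoeff-suc i k rewrite m+n∸m≡n (suc i) (suc k) = begin
    ((suc i + suc k) * a) / suc k ≡⟨ cong (_/ suc k) numerator ⟩
    ((a + x) * suc k) / suc k     ≡⟨ m*n/n≡m (a + x) (suc k) ⟩
    a + x                         ∎
    where
    a = suc k C suc i
    x = k C i
    numerator : (suc i + suc k) * a ≡ (a + x) * suc k
    numerator = begin
      (suc i + suc k) * a     ≡⟨ *-distribʳ-+ a (suc i) (suc k) ⟩
      suc i * a + suc k * a   ≡⟨ cong (_+ suc k * a) ([i+1]*[k+1]C[i+1]≡[k+1]*kCi k i) ⟩
      suc k * x + suc k * a   ≡⟨ solve 3 (λ k x a → k :* x :+ k :* a := (a :+ x) :* k) refl (suc k) x a ⟩
      (a + x) * suc k         ∎

  lucasCoeff-pascal : ∀ {n i} → i < n →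
    lucasCoeff (suc (suc n)) (suc i) ≡ lucasCoeff (suc n) (suc i) + lucasCoeff n i
  lucasCoeff-pascal {i = i} i<n with m≤n⇒∃[o]m+o≡n i<n
  ... | k , refl = begin
    lucasCoeff (suc (suc (suc i + k))) (suc i)
      ≡⟨ cong (λ n → lucasCoeff n (suc i)) (solve 2 (λ i k → con 3 :+ i :+ k := con 1 :+ i :+ (con 2 :+ k)) refl i k) ⟩
    lucasCoeff (suc i + suc (suc k)) (suc i)
      ≡⟨ lucasCoeff-suc i (suc k) ⟩
    suc (suc k) C suc i + suc k C i
      ≡⟨ closedForms i ⟩
    (suc k C suc i + k C i) + lucasCoeff (suc i + k) i
      ≡⟨ cong (_+ lucasCoeff (suc i + k) i) (lucasCoeff-suc i k) ⟨
    lucasCoeff (suc i + suc k) (suc i) + lucasCoeff (suc i + k) i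
      ≡⟨ cong (λ n → lucasCoeff n (suc i) + lucasCoeff (suc i + k) i) (+-suc (suc i) k) ⟩
    lucasCoeff (suc (suc i + k)) (suc i) + lucasCoeff (suc i + k) i ∎
    where
    closedForms : ∀ i → suc (suc k) C suc i + suc k C i ≡ (suc k C suc i + k C i) + lucasCoeff (suc i + k) i
    closedForms zero rewrite nC1≡n (suc (suc k)) | nC1≡n (suc k) | lucasCoeff-zero k =
      solve 1 (λ k → con 2 :+ k :+ con 1 := con 1 :+ k :+ con 1 :+ con 1) refl k
    closedForms (suc j) = begin
      suc (suc k) C suc (suc j) + suc k C suc j
        ≡⟨ cong₂ _+_ (trans ([n+1]C[k+1]≡nCk+nC[k+1] (suc k) (suc j)) (cong (_+ c) ([n+1]C[k+1]≡nCk+nC[k+1] k j)))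
                     ([n+1]C[k+1]≡nCk+nC[k+1] k j) ⟩
      ((a + b) + c) + (a + b)
        ≡⟨ solve 3 (λ a b c → ((a :+ b) :+ c) :+ (a :+ b) := (c :+ b) :+ ((a :+ b) :+ a)) refl a b c ⟩
      (c + b) + ((a + b) + a)
        ≡⟨ cong (λ x → (c + b) + (x + a)) ([n+1]C[k+1]≡nCk+nC[k+1] k j) ⟨
      (c + b) + (suc k C suc j + k C j)
        ≡⟨ cong ((c + b) +_) (lucasCoeff-suc j k) ⟨
      (c + b) + lucasCoeff (suc j + suc k) (suc j)
        ≡⟨ cong (λ n → (c + b) + lucasCoeff n (suc j)) (+-suc (suc j) k) ⟩
      (c + b) + lucasCoeff (suc (suc j) + k) (suc j) ∎
      where
      a = k C j
      b = k C suc j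
      c = suc k C suc (suc j)

  lucasCoeff-middle : ∀ i → lucasCoeff (suc (2 * suc i)) (suc (suc i)) ≡ 0
  lucasCoeff-middle i = begin
    lucasCoeff (suc (suc i + (suc i + 0))) (suc (suc i))
      ≡⟨ cong (λ m → lucasCoeff (suc (suc i + m)) (suc (suc i))) (+-identityʳ (suc i)) ⟩
    lucasCoeff (suc (suc i) + suc i) (suc (suc i))
      ≡⟨ lucasCoeff-suc (suc i) i ⟩
    suc i C suc (suc i) + i C suc i
      ≡⟨ cong₂ _+_ (k>n⇒nCk≡0 {suc i} {suc (suc i)} (n<1+n _)) (k>n⇒nCk≡0 {i} {suc i} (n<1+n _)) ⟩
    0 ∎

  lucasCoeff-tail : ∀ i m → lucasCoeff (m + 2 * suc i) (suc i) ≡ (suc i + m) C suc i + (i + m) C i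
  lucasCoeff-tail i m = begin
    lucasCoeff (m + 2 * suc i) (suc i)
      ≡⟨ cong (λ n → lucasCoeff n (suc i))
              (solve 2 (λ i m → m :+ con 2 :* (con 1 :+ i) := con 1 :+ i :+ (con 1 :+ (i :+ m))) refl i m) ⟩
    lucasCoeff (suc i + suc (i + m)) (suc i)
      ≡⟨ lucasCoeff-suc i (i + m) ⟩
    (suc i + m) C suc i + (i + m) C i ∎

  2*i≤n⇒i<n : ∀ {i n} → 1 ≤ n → 2 * i ≤ n → i < n
  2*i≤n⇒i<n {zero} 1≤n _ = 1≤n
  2*i≤n⇒i<n {suc i} _ 2i≤n = <-≤-trans (m<m+n (suc i) (s≤s z≤n)) 2i≤n

open LucasCoefficients

module PowerSeries {c ℓ} (R : CommutativeRing c ℓ) where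

  open CommutativeRing R
  open Lucas R
  open import Algebra.Properties.Semiring.Sum semiring
    using (sum; sum-cong-≋; sum-cong-≗; sum-replicate-zero; ∑-distrib-+; *-distribˡ-sum; sum-init-last; ∑-permute)
  open import Algebra.Properties.Group +-group using (inverseʳ-unique)
  open import Algebra.Solver.Ring.NaturalCoefficients.Default commutativeSemiring
    using (solve; _:=_; _:+_; _:*_; con)
  open import Relation.Binary.Reasoning.Setoid setoid

  ΣFin≡sum : ∀ n (f : Fin n → Carrier) → ΣFin n f ≡ sum f
  ΣFin≡sum zero f = ≡.refl
  ΣFin≡sum (suc n) f = ≡.cong (f Fin.zero +_) (ΣFin≡sum n (λ j → f (Fin.suc j)))

  Σ≤≡sum : ∀ m (f : ℕ → Carrier) → Σ≤ m f ≡ sum {suc m} (λ j → f (toℕ j))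
  Σ≤≡sum m f = ΣFin≡sum (suc m) (λ j → f (toℕ j))

  Σ≤-cong : ∀ m {f g : ℕ → Carrier} → (∀ {k} → k N.≤ m → f k ≈ g k) → Σ≤ m f ≈ Σ≤ m g
  Σ≤-cong m {f} {g} f≈g = begin
    Σ≤ m f                         ≡⟨ Σ≤≡sum m f ⟩
    sum {suc m} (λ j → f (toℕ j))  ≈⟨ sum-cong-≋ {suc m} (λ j → f≈g (N.≤-pred (toℕ<n j))) ⟩
    sum {suc m} (λ j → g (toℕ j))  ≡⟨ Σ≤≡sum m g ⟨
    Σ≤ m g                         ∎

  Σ≤-zero : ∀ m (f : ℕ → Carrier) → (∀ k → f k ≈ 0#) → Σ≤ m f ≈ 0#
  Σ≤-zero m f f≈0 = begin
    Σ≤ m f                         ≡⟨ Σ≤≡sum m f ⟩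
    sum {suc m} (λ j → f (toℕ j))  ≈⟨ sum-cong-≋ {suc m} (λ j → f≈0 (toℕ j)) ⟩
    sum {suc m} (λ _ → 0#)         ≈⟨ sum-replicate-zero (suc m) ⟩
    0#                             ∎

  Σ≤-distrib-+ : ∀ m (f g : ℕ → Carrier) → Σ≤ m (λ k → f k + g k) ≈ Σ≤ m f + Σ≤ m g
  Σ≤-distrib-+ m f g = begin
    Σ≤ m (λ k → f k + g k)
      ≡⟨ Σ≤≡sum m (λ k → f k + g k) ⟩
    sum {suc m} (λ j → f (toℕ j) + g (toℕ j))
      ≈⟨ ∑-distrib-+ {suc m} (λ j → f (toℕ j)) (λ j → g (toℕ j)) ⟩
    sum {suc m} (λ j → f (toℕ j)) + sum {suc m} (λ j → g (toℕ j))
      ≡⟨ ≡.cong₂ _+_ (Σ≤≡sum m f) (Σ≤≡sum m g) ⟨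
    Σ≤ m f + Σ≤ m g
      ∎

  *-distribˡ-Σ≤ : ∀ m a (f : ℕ → Carrier) → a * Σ≤ m f ≈ Σ≤ m (λ k → a * f k)
  *-distribˡ-Σ≤ m a f = begin
    a * Σ≤ m f                         ≡⟨ ≡.cong (a *_) (Σ≤≡sum m f) ⟩
    a * sum {suc m} (λ j → f (toℕ j))  ≈⟨ *-distribˡ-sum {suc m} a (λ j → f (toℕ j)) ⟩
    sum {suc m} (λ j → a * f (toℕ j))  ≡⟨ Σ≤≡sum m (λ k → a * f k) ⟨
    Σ≤ m (λ k → a * f k)               ∎

  Σ≤-snoc : ∀ m (f : ℕ → Carrier) → Σ≤ (suc m) f ≈ Σ≤ m f + f (suc m)
  Σ≤-snoc m f = begin
    Σ≤ (suc m) f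
      ≡⟨ Σ≤≡sum (suc m) f ⟩
    sum {suc (suc m)} (λ j → f (toℕ j))
      ≈⟨ sum-init-last {suc m} (λ j → f (toℕ j)) ⟩
    sum {suc m} (λ j → f (toℕ (inject₁ j))) + f (toℕ (fromℕ (suc m)))
      ≡⟨ ≡.cong₂ _+_ (sum-cong-≗ {suc m} (λ j → ≡.cong f (toℕ-inject₁ j))) (≡.cong f (toℕ-fromℕ (suc m))) ⟩
    sum {suc m} (λ j → f (toℕ j)) + f (suc m)
      ≡⟨ ≡.cong (_+ f (suc m)) (Σ≤≡sum m f) ⟨
    Σ≤ m f + f (suc m)
      ∎

  Σ≤-reverse : ∀ m (f : ℕ → Carrier) → Σ≤ m f ≈ Σ≤ m (λ k → f (m ∸ k))
  Σ≤-reverse m f = begin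
    Σ≤ m f                                        ≡⟨ Σ≤≡sum m f ⟩
    sum {suc m} (λ j → f (toℕ j))                 ≈⟨ ∑-permute {suc m} (λ j → f (toℕ j)) reverse ⟩
    sum {suc m} (λ j → f (toℕ (Fin.opposite j)))  ≡⟨ sum-cong-≗ {suc m} (λ j → ≡.cong f (opposite-prop j)) ⟩
    sum {suc m} (λ j → f (m ∸ toℕ j))             ≡⟨ Σ≤≡sum m (λ k → f (m ∸ k)) ⟨
    Σ≤ m (λ k → f (m ∸ k))                        ∎

  infix 4 _≐_
  _≐_ : PS → PS → Set ℓ
  f ≐ g = ∀ n → f n ≈ g n

  ≐-refl : ∀ {f} → f ≐ f
  ≐-refl n = refl

  ≐-reflexive : ∀ {f g} → f ≡ g → f ≐ g
  ≐-reflexive ≡.refl n = refl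

  ≐-sym : ∀ {f g} → f ≐ g → g ≐ f
  ≐-sym f≐g n = sym (f≐g n)

  ≐-trans : ∀ {f g k} → f ≐ g → g ≐ k → f ≐ k
  ≐-trans f≐g g≐k n = trans (f≐g n) (g≐k n)

  scale : Carrier → PS → PS
  scale a f n = a * f n

  tail : PS → PS
  tail f n = f (suc n)

  shift : PS → PS
  shift f zero = 0#
  shift f (suc n) = f n

  shiftBy : ℕ → PS → PS
  shiftBy zero f = f
  shiftBy (suc k) f = shift (shiftBy k f)

  shiftBy-below : ∀ k f {n} → n N.< k → shiftBy k f n ≈ 0#
  shiftBy-below (suc k) f {zero} _ = refl
  shiftBy-below (suc k) f {suc n} n<k = shiftBy-below k f (N.≤-pred n<k)

  shiftBy-+ : ∀ k f m → shiftBy k f (k N.+ m) ≡ f m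
  shiftBy-+ zero f m = ≡.refl
  shiftBy-+ (suc k) f m = shiftBy-+ k f m

  ⊛-cong : ∀ {f f′ g g′} → f ≐ f′ → g ≐ g′ → f ⊛ g ≐ f′ ⊛ g′
  ⊛-cong f≐f′ g≐g′ n = Σ≤-cong n (λ {k} _ → *-cong (f≐f′ k) (g≐g′ (n ∸ k)))

  ⊛-congˡ : ∀ f {g g′} → g ≐ g′ → f ⊛ g ≐ f ⊛ g′
  ⊛-congˡ f = ⊛-cong {f = f} ≐-refl

  ⊛-congʳ : ∀ {f f′} g → f ≐ f′ → f ⊛ g ≐ f′ ⊛ g
  ⊛-congʳ g f≐f′ = ⊛-cong {g = g} f≐f′ ≐-refl

  ⊛-distribʳ-⊕ : ∀ f g k → (f ⊕ g) ⊛ k ≐ (f ⊛ k) ⊕ (g ⊛ k)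
  ⊛-distribʳ-⊕ f g k n = trans
    (Σ≤-cong n {g = λ i → f i * k (n ∸ i) + g i * k (n ∸ i)} (λ {i} _ → distribʳ (k (n ∸ i)) (f i) (g i)))
    (Σ≤-distrib-+ n (λ i → f i * k (n ∸ i)) (λ i → g i * k (n ∸ i)))

  ⊛-distribʳ-⊝ : ∀ f k → (⊝ f) ⊛ k ≐ ⊝ (f ⊛ k)
  ⊛-distribʳ-⊝ f k n = inverseʳ-unique _ _ (begin
    (f ⊛ k) n + ((⊝ f) ⊛ k) n  ≈⟨ ⊛-distribʳ-⊕ f (⊝ f) k n ⟨
    ((f ⊖ f) ⊛ k) n            ≈⟨ Σ≤-zero n _ (λ i → trans (*-congʳ (-‿inverseʳ (f i))) (zeroˡ (k (n ∸ i)))) ⟩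
    0#                         ∎)

  scale-⊛ : ∀ a f k → scale a f ⊛ k ≐ scale a (f ⊛ k)
  scale-⊛ a f k n = trans
    (Σ≤-cong n {g = λ i → a * (f i * k (n ∸ i))} (λ {i} _ → *-assoc a (f i) (k (n ∸ i))))
    (sym (*-distribˡ-Σ≤ n a (λ i → f i * k (n ∸ i))))

  const-⊛ : ∀ a f → const a ⊛ f ≐ scale a f
  const-⊛ a f zero = +-identityʳ _
  const-⊛ a f (suc n) = trans (+-congˡ (Σ≤-zero n _ (λ i → zeroˡ (f (n ∸ i))))) (+-identityʳ _)

  one-⊛ : ∀ f → const 1# ⊛ f ≐ f
  one-⊛ f n = trans (const-⊛ 1# f n) (*-identityˡ _)

  T-⊛ : ∀ f → T ⊛ f ≐ shift f
  T-⊛ f zero = trans (+-identityʳ _) (zeroˡ _)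
  T-⊛ f (suc n) = begin
    0# * f (suc n) + (tail T ⊛ f) n  ≈⟨ +-cong (zeroˡ _) (⊛-congʳ f tail-T n) ⟩
    0# + (const 1# ⊛ f) n            ≈⟨ +-identityˡ _ ⟩
    (const 1# ⊛ f) n                 ≈⟨ one-⊛ f n ⟩
    f n                              ∎
    where
    tail-T : tail T ≐ const 1#
    tail-T zero = refl
    tail-T (suc _) = refl

  ⊛-comm : ∀ f g → f ⊛ g ≐ g ⊛ f
  ⊛-comm f g n = trans (Σ≤-reverse n (λ i → f i * g (n ∸ i)))
    (Σ≤-cong n {g = λ i → g i * f (n ∸ i)} (λ {i} i≤n →
      trans (*-comm _ _) (*-congʳ (reflexive (≡.cong g (N.m∸[m∸n]≡n i≤n))))))

  ⊛-assoc : ∀ f g k → (f ⊛ g) ⊛ k ≐ f ⊛ (g ⊛ k)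
  ⊛-assoc f g k zero =
    solve 3 (λ a b c → (a :* b :+ con 0) :* c :+ con 0 := a :* (b :* c :+ con 0) :+ con 0) refl (f 0) (g 0) (k 0)
  ⊛-assoc f g k (suc n) = begin
    -- tail (f ⊛ g) is definitionally scale (f 0) (tail g) ⊕ (tail f ⊛ g)
    (f ⊛ g) 0 * k (suc n) + ((scale (f 0) (tail g) ⊕ (tail f ⊛ g)) ⊛ k) n
      ≈⟨ +-congˡ (⊛-distribʳ-⊕ (scale (f 0) (tail g)) (tail f ⊛ g) k n) ⟩
    (f ⊛ g) 0 * k (suc n) + ((scale (f 0) (tail g) ⊛ k) n + ((tail f ⊛ g) ⊛ k) n)
      ≈⟨ +-congˡ (+-cong (scale-⊛ (f 0) (tail g) k n) (⊛-assoc (tail f) g k n)) ⟩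
    (f 0 * g 0 + 0#) * k (suc n) + (f 0 * (tail g ⊛ k) n + (tail f ⊛ (g ⊛ k)) n)
      ≈⟨ solve 5 (λ a b c d e → (a :* b :+ con 0) :* c :+ (a :* d :+ e) := a :* (b :* c :+ d) :+ e)
           refl (f 0) (g 0) (k (suc n)) ((tail g ⊛ k) n) ((tail f ⊛ (g ⊛ k)) n) ⟩
    f 0 * (g ⊛ k) (suc n) + (tail f ⊛ (g ⊛ k)) n
      ∎

  ⊛-identityʳ : ∀ f → f ⊛ const 1# ≐ f
  ⊛-identityʳ f = ≐-trans (⊛-comm f (const 1#)) (one-⊛ f)

  T^-⊛ : ∀ k f → (T ⊛^ k) ⊛ f ≐ shiftBy k f
  T^-⊛ zero f = one-⊛ f
  T^-⊛ (suc k) f = ≐-trans (⊛-assoc T (T ⊛^ k) f)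
    (≐-trans (⊛-congˡ T (T^-⊛ k f)) (T-⊛ (shiftBy k f)))

  invVec-lookup : ∀ f n (j : Fin (suc n)) → lookup (invVec f n) j ≡ inv f (n ∸ toℕ j)
  invVec-lookup f zero Fin.zero = ≡.refl
  invVec-lookup f (suc n) Fin.zero = ≡.refl
  invVec-lookup f (suc n) (Fin.suc j) = invVec-lookup f n j

  ⊛-inverseʳ : ∀ f → f 0 ≈ 1# → f ⊛ inv f ≐ const 1#
  ⊛-inverseʳ f f₀≈1 zero = trans (+-identityʳ _) (trans (*-cong f₀≈1 refl) (*-identityˡ _))
  ⊛-inverseʳ f f₀≈1 (suc n) = begin
    f 0 * inv f (suc n) + (tail f ⊛ inv f) n
      ≈⟨ +-congʳ (*-cong f₀≈1 (-‿cong (reflexive inv-coefficient))) ⟩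
    1# * - (tail f ⊛ inv f) n + (tail f ⊛ inv f) n  ≈⟨ +-congʳ (*-identityˡ _) ⟩
    - (tail f ⊛ inv f) n + (tail f ⊛ inv f) n       ≈⟨ -‿inverseˡ _ ⟩
    0#                                              ∎
    where
    inv-coefficient : ΣFin (suc n) (λ j → f (suc (toℕ j)) * lookup (invVec f n) j) ≡ (tail f ⊛ inv f) n
    inv-coefficient = ≡.trans (ΣFin≡sum (suc n) (λ j → f (suc (toℕ j)) * lookup (invVec f n) j))
      (≡.trans (sum-cong-≗ {suc n} (λ j → ≡.cong (f (suc (toℕ j)) *_) (invVec-lookup f n j)))
               (≡.sym (Σ≤≡sum n (λ k → f (suc k) * inv f (n ∸ k)))))

  ⊛^-constantTerm : ∀ f k → f 0 ≈ 1# → (f ⊛^ k) 0 ≈ 1#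
  ⊛^-constantTerm f zero f₀≈1 = refl
  ⊛^-constantTerm f (suc k) f₀≈1 =
    trans (+-identityʳ _) (trans (*-cong f₀≈1 (⊛^-constantTerm f k f₀≈1)) (*-identityˡ _))

  ⊛-⊘-cancel : ∀ g d → d 0 ≈ 1# → (g ⊛ d) ⊘ d ≐ g
  ⊛-⊘-cancel g d d₀≈1 = ≐-trans (⊛-assoc g d (inv d))
    (≐-trans (⊛-congˡ g (⊛-inverseʳ d d₀≈1)) (⊛-identityʳ g))

module IncompleteLucas {c ℓ} (R : CommutativeRing c ℓ) (h : CommutativeRing.Carrier R) where

  open CommutativeRing R
  open Lucas R
  open PowerSeries R
  open import Algebra.Properties.Group +-group using (ε⁻¹≈ε; //-rightDividesʳ)
  open import Algebra.Properties.AbelianGroup +-abelianGroup using (⁻¹-∙-comm)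
  open import Algebra.Solver.Ring.NaturalCoefficients.Default commutativeSemiring
    using (solve; _:=_; _:+_; _:*_; con)
  open import Relation.Binary.Reasoning.Setoid setoid

  ⟦⟧-homo-+ : ∀ m n → ⟦ m N.+ n ⟧ ≈ ⟦ m ⟧ + ⟦ n ⟧
  ⟦⟧-homo-+ zero n = sym (+-identityˡ _)
  ⟦⟧-homo-+ (suc m) n = trans (+-congˡ (⟦⟧-homo-+ m n)) (sym (+-assoc _ _ _))

  lucasTerm : ℕ → ℕ → Carrier
  lucasTerm n i = ⟦ lucasCoeff n i ⟧ * h ^ (n ∸ 2 N.* i)

  lucasSum : ℕ → ℕ → Carrier
  lucasSum l n = Σ≤ l (lucasTerm n)

  Linc≈lucasSum : ∀ {l n} → 2 N.* l N.≤ n → Linc h l n ≈ lucasSum l n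
  Linc≈lucasSum {l} {n} 2l≤n with 2 N.* l ≤? n
  ... | yes _ = refl
  ... | no 2l≰n = ⊥-elim (2l≰n 2l≤n)

  Linc≈0 : ∀ {l n} → n N.< 2 N.* l → Linc h l n ≈ 0#
  Linc≈0 {l} {n} n<2l with 2 N.* l ≤? n
  ... | yes 2l≤n = ⊥-elim (N.<⇒≱ n<2l 2l≤n)
  ... | no _ = refl

  lucasTerm-zero : ∀ n → lucasTerm (suc (suc n)) 0 ≈ h * lucasTerm (suc n) 0
  lucasTerm-zero n rewrite lucasCoeff-zero (suc n) | lucasCoeff-zero n =
    solve 3 (λ a h p → a :* (h :* p) := h :* (a :* p)) refl ⟦ 1 ⟧ h (h ^ suc n)

  -- For d = 0 truncated subtraction breaks h^(n-2i) = h·h^((n+1)-2(i+1)), but there the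
  -- coefficient c(2i+1, i+1) vanishes.
  lucasTerm-factor-h : ∀ i d → 1 N.≤ 2 N.* i N.+ d →
    let n = 2 N.* i N.+ d in ⟦ lucasCoeff (suc n) (suc i) ⟧ * h ^ (n ∸ 2 N.* i) ≈ h * lucasTerm (suc n) (suc i)
  lucasTerm-factor-h i (suc e) _ = begin
    ⟦ a ⟧ * h ^ (2 N.* i N.+ suc e ∸ 2 N.* i)  ≡⟨ ≡.cong (λ k → ⟦ a ⟧ * h ^ k) (N.m+n∸m≡n (2 N.* i) (suc e)) ⟩
    ⟦ a ⟧ * (h * h ^ e)                       ≈⟨ solve 3 (λ a h p → a :* (h :* p) := h :* (a :* p)) refl ⟦ a ⟧ h (h ^ e) ⟩
    h * (⟦ a ⟧ * h ^ e)                       ≡⟨ ≡.cong (λ k → h * (⟦ a ⟧ * h ^ k)) exponent ⟨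
    h * lucasTerm (suc (2 N.* i N.+ suc e)) (suc i) ∎
    where
    a = lucasCoeff (suc (2 N.* i N.+ suc e)) (suc i)
    exponent : suc (2 N.* i N.+ suc e) ∸ 2 N.* suc i ≡ e
    exponent = ≡.trans (≡.cong (suc (2 N.* i N.+ suc e) ∸_) (N.*-suc 2 i))
      (≡.trans (≡.cong (_∸ suc (2 N.* i)) (N.+-suc (2 N.* i) e)) (N.m+n∸m≡n (2 N.* i) e))
  lucasTerm-factor-h zero zero ()
  lucasTerm-factor-h (suc j) zero _ = begin
    ⟦ a ⟧ * h ^ (2 N.* suc j N.+ 0 ∸ 2 N.* suc j) ≈⟨ *-congʳ a≈0 ⟩
    0# * _                                     ≈⟨ zeroˡ _ ⟩
    0#                                         ≈⟨ zeroʳ h ⟨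
    h * 0#                                     ≈⟨ *-congˡ (zeroˡ _) ⟨
    h * (0# * _)                               ≈⟨ *-congˡ (*-congʳ a≈0) ⟨
    h * lucasTerm (suc (2 N.* suc j N.+ 0)) (suc (suc j)) ∎
    where
    a = lucasCoeff (suc (2 N.* suc j N.+ 0)) (suc (suc j))
    a≈0 : ⟦ a ⟧ ≈ 0#
    a≈0 = reflexive (≡.cong ⟦_⟧ (≡.trans
      (≡.cong (λ m → lucasCoeff (suc m) (suc (suc j))) (N.+-identityʳ (2 N.* suc j)))
      (lucasCoeff-middle j)))

  lucasTerm-suc : ∀ {n i} → 1 N.≤ n → 2 N.* i N.≤ n →
    lucasTerm (suc (suc n)) (suc i) ≈ h * lucasTerm (suc n) (suc i) + lucasTerm n i
  lucasTerm-suc {n} {i} 1≤n 2i≤n = begin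
    ⟦ lucasCoeff (suc (suc n)) (suc i) ⟧ * h ^ (suc (suc n) ∸ 2 N.* suc i)
      ≡⟨ ≡.cong₂ (λ c e → ⟦ c ⟧ * h ^ e) (lucasCoeff-pascal {n} {i} (2*i≤n⇒i<n 1≤n 2i≤n))
                                        (≡.cong (suc (suc n) ∸_) (N.*-suc 2 i)) ⟩
    ⟦ a N.+ lucasCoeff n i ⟧ * h ^ (n ∸ 2 N.* i)
      ≈⟨ trans (*-congʳ (⟦⟧-homo-+ a (lucasCoeff n i))) (distribʳ _ _ _) ⟩
    ⟦ a ⟧ * h ^ (n ∸ 2 N.* i) + lucasTerm n i
      ≈⟨ +-congʳ leading ⟩
    h * lucasTerm (suc n) (suc i) + lucasTerm n i
      ∎
    where
    a = lucasCoeff (suc n) (suc i)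
    leading : ⟦ a ⟧ * h ^ (n ∸ 2 N.* i) ≈ h * lucasTerm (suc n) (suc i)
    leading with N.m≤n⇒∃[o]m+o≡n 2i≤n
    ... | d , 2i+d≡n = ≡.subst (λ n → ⟦ lucasCoeff (suc n) (suc i) ⟧ * h ^ (n ∸ 2 N.* i) ≈ h * lucasTerm (suc n) (suc i))
      2i+d≡n (lucasTerm-factor-h i d (≡.subst (1 N.≤_) (≡.sym 2i+d≡n) 1≤n))

  lucasSum-suc : ∀ {l n} → 1 N.≤ n → 2 N.* l N.≤ n →
    lucasSum (suc l) (suc (suc n)) ≈ h * lucasSum (suc l) (suc n) + lucasSum l n
  lucasSum-suc {l} {n} 1≤n 2l≤n = begin
    lucasTerm (suc (suc n)) 0 + Σ≤ l (upper (suc (suc n)))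
      ≈⟨ +-cong (lucasTerm-zero n) (Σ≤-cong l {g = λ i → h * upper (suc n) i + lucasTerm n i} termwise) ⟩
    h * lucasTerm (suc n) 0 + Σ≤ l (λ i → h * upper (suc n) i + lucasTerm n i)
      ≈⟨ +-congˡ (Σ≤-distrib-+ l (λ i → h * upper (suc n) i) (lucasTerm n)) ⟩
    h * lucasTerm (suc n) 0 + (Σ≤ l (λ i → h * upper (suc n) i) + lucasSum l n)
      ≈⟨ +-congˡ (+-congʳ (*-distribˡ-Σ≤ l h (upper (suc n)))) ⟨
    h * lucasTerm (suc n) 0 + (h * Σ≤ l (upper (suc n)) + lucasSum l n)
      ≈⟨ solve 4 (λ h a b c → h :* a :+ (h :* b :+ c) := h :* (a :+ b) :+ c) refl h _ _ _ ⟩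
    h * lucasSum (suc l) (suc n) + lucasSum l n
      ∎
    where
    upper : ℕ → ℕ → Carrier
    upper m i = lucasTerm m (suc i)
    termwise : ∀ {i} → i N.≤ l → upper (suc (suc n)) i ≈ h * upper (suc n) i + lucasTerm n i
    termwise {i} i≤l = lucasTerm-suc {n} {i} 1≤n (N.≤-trans (N.*-monoʳ-≤ 2 i≤l) 2l≤n)

  lucasSum-snoc : ∀ l n → lucasSum (suc l) n ≈ lucasSum l n + lucasTerm n (suc l)
  lucasSum-snoc l n = Σ≤-snoc l (lucasTerm n)

  lucasSum-diagonal : ∀ l → lucasSum (suc l) (2 N.* suc l) ≈ L h (2 N.* suc l)
                          × lucasSum (suc l) (suc (2 N.* suc l)) ≈ L h (suc (2 N.* suc l))
  lucasSum-diagonal zero = even , odd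
    where
    ⟦1⟧ : ⟦ 1 ⟧ ≈ 1#
    ⟦1⟧ = +-identityʳ 1#
    ⟦2⟧ : ⟦ 2 ⟧ ≈ 1# + 1#
    ⟦2⟧ = +-congˡ ⟦1⟧
    ⟦3⟧ : ⟦ 3 ⟧ ≈ 1# + (1# + 1#)
    ⟦3⟧ = +-congˡ ⟦2⟧
    even : ⟦ 1 ⟧ * (h * (h * 1#)) + (⟦ 2 ⟧ * 1# + 0#) ≈ h * h + (1# + 1#)
    even = begin
      ⟦ 1 ⟧ * (h * (h * 1#)) + (⟦ 2 ⟧ * 1# + 0#)      ≈⟨ +-cong (*-congʳ ⟦1⟧) (+-congʳ (*-congʳ ⟦2⟧)) ⟩
      1# * (h * (h * 1#)) + ((1# + 1#) * 1# + 0#)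
        ≈⟨ solve 1 (λ h → con 1 :* (h :* (h :* con 1)) :+ ((con 1 :+ con 1) :* con 1 :+ con 0)
                         := h :* h :+ (con 1 :+ con 1)) refl h ⟩
      h * h + (1# + 1#)                                ∎
    odd : ⟦ 1 ⟧ * (h * (h * (h * 1#))) + (⟦ 3 ⟧ * (h * 1#) + 0#) ≈ h * (h * h + (1# + 1#)) + h
    odd = begin
      ⟦ 1 ⟧ * (h * (h * (h * 1#))) + (⟦ 3 ⟧ * (h * 1#) + 0#) ≈⟨ +-cong (*-congʳ ⟦1⟧) (+-congʳ (*-congʳ ⟦3⟧)) ⟩
      1# * (h * (h * (h * 1#))) + ((1# + (1# + 1#)) * (h * 1#) + 0#)
        ≈⟨ solve 1 (λ h → con 1 :* (h :* (h :* (h :* con 1))) :+ ((con 1 :+ (con 1 :+ con 1)) :* (h :* con 1) :+ con 0)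
                         := h :* (h :* h :+ (con 1 :+ con 1)) :+ h) refl h ⟩
      h * (h * h + (1# + 1#)) + h                                ∎
  lucasSum-diagonal (suc l) =
    ≡.subst (λ n → lucasSum (suc (suc l)) n ≈ L h n) (≡.sym 2l+2≡) even ,
    ≡.subst (λ n → lucasSum (suc (suc l)) (suc n) ≈ L h (suc n)) (≡.sym 2l+2≡) odd
    where
    n = 2 N.* suc l
    2l+2≡ : 2 N.* suc (suc l) ≡ suc (suc n)
    2l+2≡ = N.*-suc 2 (suc l)
    ih = lucasSum-diagonal l
    1≤n : 1 N.≤ n
    1≤n = s≤s z≤n
    middle : lucasSum (suc (suc l)) (suc n) ≈ lucasSum (suc l) (suc n)
    middle = begin
      lucasSum (suc (suc l)) (suc n)                        ≈⟨ lucasSum-snoc (suc l) (suc n) ⟩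
      lucasSum (suc l) (suc n) + lucasTerm (suc n) (suc (suc l))
        ≈⟨ +-congˡ (trans (*-congʳ (reflexive (≡.cong ⟦_⟧ (lucasCoeff-middle l)))) (zeroˡ _)) ⟩
      lucasSum (suc l) (suc n) + 0#                         ≈⟨ +-identityʳ _ ⟩
      lucasSum (suc l) (suc n)                              ∎
    even : lucasSum (suc (suc l)) (suc (suc n)) ≈ L h (suc (suc n))
    even = begin
      lucasSum (suc (suc l)) (suc (suc n))                  ≈⟨ lucasSum-suc {suc l} 1≤n N.≤-refl ⟩
      h * lucasSum (suc (suc l)) (suc n) + lucasSum (suc l) n ≈⟨ +-cong (*-congˡ (trans middle (proj₂ ih))) (proj₁ ih) ⟩
      h * L h (suc n) + L h n                               ∎
    odd : lucasSum (suc (suc l)) (suc (suc (suc n))) ≈ L h (suc (suc (suc n)))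
    odd = begin
      lucasSum (suc (suc l)) (suc (suc (suc n)))            ≈⟨ lucasSum-suc {suc l} (s≤s z≤n) (N.n≤1+n n) ⟩
      h * lucasSum (suc (suc l)) (suc (suc n)) + lucasSum (suc l) (suc n) ≈⟨ +-cong (*-congˡ even) (proj₂ ih) ⟩
      h * L h (suc (suc n)) + L h (suc n)                   ∎

  x≈y+w∧z≈w+v⇒x-y-z≈-v : ∀ {x y z w v} → x ≈ y + w → z ≈ w + v → (x - y) - z ≈ - v
  x≈y+w∧z≈w+v⇒x-y-z≈-v {x} {y} {z} {w} {v} x≈y+w z≈w+v = begin
    (x - y) - z               ≈⟨ +-cong (+-congʳ (trans x≈y+w (+-comm y w))) (-‿cong z≈w+v) ⟩
    ((w + y) - y) - (w + v)   ≈⟨ +-cong (//-rightDividesʳ y w) (sym (⁻¹-∙-comm w v)) ⟩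
    w + (- w + - v)           ≈⟨ sym (+-assoc w (- w) (- v)) ⟩
    (w - w) + - v             ≈⟨ +-congʳ (-‿inverseʳ w) ⟩
    0# + - v                  ≈⟨ +-identityˡ (- v) ⟩
    - v                       ∎

  1-hT : PS
  1-hT = const 1# ⊖ (const h ⊛ T)

  1-hT-T² : PS
  1-hT-T² = 1-hT ⊖ (T ⊛^ 2)

  2-hT : PS
  2-hT = const (1# + 1#) ⊖ (const h ⊛ T)

  hT-⊛ : ∀ g → (const h ⊛ T) ⊛ g ≐ scale h (shift g)
  hT-⊛ g = ≐-trans (⊛-assoc (const h) T g) (≐-trans (⊛-congˡ (const h) (T-⊛ g)) (const-⊛ h (shift g)))

  1-hT-⊛ : ∀ g → 1-hT ⊛ g ≐ λ n → g n - h * shift g n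
  1-hT-⊛ g n = begin
    (1-hT ⊛ g) n
      ≈⟨ ⊛-distribʳ-⊕ (const 1#) (⊝ (const h ⊛ T)) g n ⟩
    (const 1# ⊛ g) n + ((⊝ (const h ⊛ T)) ⊛ g) n
      ≈⟨ +-cong (one-⊛ g n) (trans (⊛-distribʳ-⊝ (const h ⊛ T) g n) (-‿cong (hT-⊛ g n))) ⟩
    g n - h * shift g n
      ∎

  1-hT-T²-⊛ : ∀ g → 1-hT-T² ⊛ g ≐ λ n → (g n - h * shift g n) - shift (shift g) n
  1-hT-T²-⊛ g n = begin
    (1-hT-T² ⊛ g) n
      ≈⟨ ⊛-distribʳ-⊕ 1-hT (⊝ (T ⊛^ 2)) g n ⟩
    (1-hT ⊛ g) n + ((⊝ (T ⊛^ 2)) ⊛ g) n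
      ≈⟨ +-cong (1-hT-⊛ g n) (trans (⊛-distribʳ-⊝ (T ⊛^ 2) g n) (-‿cong (T^-⊛ 2 g n))) ⟩
    (g n - h * shift g n) - shift (shift g) n
      ∎

  -[h*0]≈0 : - (h * 0#) ≈ 0#
  -[h*0]≈0 = trans (-‿cong (zeroʳ h)) ε⁻¹≈ε

  1-hT-constantTerm : 1-hT 0 ≈ 1#
  1-hT-constantTerm = trans (+-congˡ (trans (-‿cong (+-identityʳ _)) -[h*0]≈0)) (+-identityʳ 1#)

  1-hT-T²-constantTerm : 1-hT-T² 0 ≈ 1#
  1-hT-T²-constantTerm =
    trans (+-cong 1-hT-constantTerm (trans (-‿cong (trans (+-identityʳ _) (zeroˡ _))) ε⁻¹≈ε)) (+-identityʳ 1#)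

  negBinomial : ℕ → PS
  negBinomial j m = ⟦ (j N.+ m) C j ⟧ * h ^ m

  negBinomial-zero-⊛-1-hT : negBinomial 0 ⊛ 1-hT ≐ const 1#
  negBinomial-zero-⊛-1-hT =
    ≐-trans (⊛-comm (negBinomial 0) 1-hT) (≐-trans (1-hT-⊛ (negBinomial 0)) coefficient)
    where
    coefficient : (λ n → negBinomial 0 n - h * shift (negBinomial 0) n) ≐ const 1#
    coefficient zero = trans (+-cong (trans (*-congʳ (+-identityʳ 1#)) (*-identityʳ 1#)) -[h*0]≈0) (+-identityʳ 1#)
    coefficient (suc m) = begin
      ⟦ 1 ⟧ * (h * h ^ m) - h * (⟦ 1 ⟧ * h ^ m)
        ≈⟨ +-congʳ (solve 3 (λ a h p → a :* (h :* p) := h :* (a :* p)) refl ⟦ 1 ⟧ h (h ^ m)) ⟩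
      h * (⟦ 1 ⟧ * h ^ m) - h * (⟦ 1 ⟧ * h ^ m)   ≈⟨ -‿inverseʳ _ ⟩
      0#                                         ∎

  negBinomial-suc-⊛-1-hT : ∀ j → negBinomial (suc j) ⊛ 1-hT ≐ negBinomial j
  negBinomial-suc-⊛-1-hT j =
    ≐-trans (⊛-comm (negBinomial (suc j)) 1-hT) (≐-trans (1-hT-⊛ (negBinomial (suc j))) coefficient)
    where
    coefficient : (λ n → negBinomial (suc j) n - h * shift (negBinomial (suc j)) n) ≐ negBinomial j
    coefficient zero = begin
      ⟦ (suc j N.+ 0) C suc j ⟧ * 1# - h * 0#   ≈⟨ trans (+-congˡ -[h*0]≈0) (+-identityʳ _) ⟩
      ⟦ (suc j N.+ 0) C suc j ⟧ * 1#
        ≡⟨ ≡.cong (λ k → ⟦ k ⟧ * 1#) (≡.trans ([k+0]Ck≡1 (suc j)) (≡.sym ([k+0]Ck≡1 j))) ⟩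
      ⟦ (j N.+ 0) C j ⟧ * 1#                    ∎
      where
      [k+0]Ck≡1 : ∀ k → (k N.+ 0) C k ≡ 1
      [k+0]Ck≡1 k = ≡.trans (≡.cong (_C k) (N.+-identityʳ k)) (nCn≡1 k)
    coefficient (suc m) = begin
      ⟦ suc (j N.+ suc m) C suc j ⟧ * (h * h ^ m) - h * (⟦ y ⟧ * h ^ m)
        ≡⟨ ≡.cong (λ k → ⟦ k ⟧ * (h * h ^ m) - h * (⟦ y ⟧ * h ^ m)) split ⟩
      ⟦ x N.+ y ⟧ * (h * h ^ m) - h * (⟦ y ⟧ * h ^ m)
        ≈⟨ +-congʳ (trans (*-congʳ (⟦⟧-homo-+ x y))
             (solve 4 (λ a b h p → (a :+ b) :* (h :* p) := a :* (h :* p) :+ h :* (b :* p)) refl ⟦ x ⟧ ⟦ y ⟧ h (h ^ m))) ⟩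
      (⟦ x ⟧ * (h * h ^ m) + h * (⟦ y ⟧ * h ^ m)) - h * (⟦ y ⟧ * h ^ m)
        ≈⟨ //-rightDividesʳ _ _ ⟩
      ⟦ x ⟧ * (h * h ^ m)                                   ∎
      where
      x = (j N.+ suc m) C j
      y = (suc j N.+ m) C suc j
      split : suc (j N.+ suc m) C suc j ≡ x N.+ y
      split = ≡.trans ([n+1]C[k+1]≡nCk+nC[k+1] (j N.+ suc m) j) (≡.cong (λ n → x N.+ n C suc j) (N.+-suc j m))

  negBinomial-⊛-[1-hT]^[j+1] : ∀ j → negBinomial j ⊛ (1-hT ⊛^ suc j) ≐ const 1#
  negBinomial-⊛-[1-hT]^[j+1] zero = ≐-trans (⊛-congˡ (negBinomial 0) (⊛-identityʳ 1-hT)) negBinomial-zero-⊛-1-hT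
  negBinomial-⊛-[1-hT]^[j+1] (suc j) = ≐-trans (≐-sym (⊛-assoc (negBinomial (suc j)) 1-hT (1-hT ⊛^ suc j)))
    (≐-trans (⊛-congʳ (1-hT ⊛^ suc j) (negBinomial-suc-⊛-1-hT j)) (negBinomial-⊛-[1-hT]^[j+1] j))

  tailSeries : ℕ → PS
  tailSeries l m = Linc h l (m N.+ 2 N.* l)

  Linc≐shiftBy-tailSeries : ∀ l → Linc h l ≐ shiftBy (2 N.* l) (tailSeries l)
  Linc≐shiftBy-tailSeries l n with n N.<? 2 N.* l
  ... | yes n<2l = trans (Linc≈0 {l} n<2l) (sym (shiftBy-below (2 N.* l) (tailSeries l) n<2l))
  ... | no n≮2l = begin
    Linc h l n                                                    ≡⟨ ≡.cong (Linc h l) n≡ ⟩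
    tailSeries l (n ∸ 2 N.* l)                                    ≡⟨ shiftBy-+ (2 N.* l) (tailSeries l) _ ⟨
    shiftBy (2 N.* l) (tailSeries l) (2 N.* l N.+ (n ∸ 2 N.* l))  ≡⟨ ≡.cong (shiftBy (2 N.* l) (tailSeries l)) (N.m+[n∸m]≡n 2l≤n) ⟩
    shiftBy (2 N.* l) (tailSeries l) n                            ∎
    where
    2l≤n : 2 N.* l N.≤ n
    2l≤n = N.≮⇒≥ n≮2l
    n≡ : n ≡ (n ∸ 2 N.* l) N.+ 2 N.* l
    n≡ = ≡.sym (N.m∸n+n≡m 2l≤n)

  module _ (j : ℕ) where

    topTerm : PS
    topTerm m = lucasTerm (m N.+ 2 N.* suc j) (suc j)

    tailSeries-rec : ∀ m → (tailSeries (suc j) (suc (suc m)) - h * tailSeries (suc j) (suc m)) - tailSeries (suc j) m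
                           ≈ - topTerm m
    tailSeries-rec m = x≈y+w∧z≈w+v⇒x-y-z≈-v
      (begin
        Linc h (suc j) (suc (suc n))                    ≈⟨ Linc≈lucasSum {suc j} (N.m≤n⇒m≤1+n (N.m≤n⇒m≤1+n 2l≤n)) ⟩
        lucasSum (suc j) (suc (suc n))                  ≈⟨ lucasSum-suc {j} 1≤n 2j≤n ⟩
        h * lucasSum (suc j) (suc n) + lucasSum j n     ≈⟨ +-congʳ (*-congˡ (Linc≈lucasSum {suc j} (N.m≤n⇒m≤1+n 2l≤n))) ⟨
        h * Linc h (suc j) (suc n) + lucasSum j n       ∎)
      (trans (Linc≈lucasSum {suc j} 2l≤n) (lucasSum-snoc j n))
      where
      n = m N.+ 2 N.* suc j
      2l≤n : 2 N.* suc j N.≤ n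
      2l≤n = N.m≤n+m (2 N.* suc j) m
      1≤n : 1 N.≤ n
      1≤n = N.≤-trans (s≤s z≤n) 2l≤n
      2j≤n : 2 N.* j N.≤ n
      2j≤n = N.≤-trans (N.*-monoʳ-≤ 2 (N.n≤1+n j)) 2l≤n

    topTerm≐negBinomial : topTerm ≐ negBinomial (suc j) ⊕ negBinomial j
    topTerm≐negBinomial m = begin
      ⟦ lucasCoeff (m N.+ 2 N.* suc j) (suc j) ⟧ * h ^ (m N.+ 2 N.* suc j ∸ 2 N.* suc j)
        ≡⟨ ≡.cong₂ (λ c e → ⟦ c ⟧ * h ^ e) (lucasCoeff-tail j m) (N.m+n∸n≡m m (2 N.* suc j)) ⟩
      ⟦ (suc j N.+ m) C suc j N.+ (j N.+ m) C j ⟧ * h ^ m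
        ≈⟨ trans (*-congʳ (⟦⟧-homo-+ ((suc j N.+ m) C suc j) ((j N.+ m) C j))) (distribʳ _ _ _) ⟩
      negBinomial (suc j) m + negBinomial j m         ∎

    [1-hT]^[l+1] : PS
    [1-hT]^[l+1] = 1-hT ⊛^ (suc j N.+ 1)

    [1-hT]^[l+1]-constantTerm : [1-hT]^[l+1] 0 ≈ 1#
    [1-hT]^[l+1]-constantTerm = ⊛^-constantTerm 1-hT (suc j N.+ 1) 1-hT-constantTerm

    topTerm-⊛-[1-hT]^[l+1] : topTerm ⊛ [1-hT]^[l+1] ≐ 2-hT
    topTerm-⊛-[1-hT]^[l+1] n = begin
      (topTerm ⊛ [1-hT]^[l+1]) n
        ≈⟨ ⊛-congʳ [1-hT]^[l+1] topTerm≐negBinomial n ⟩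
      ((negBinomial (suc j) ⊕ negBinomial j) ⊛ [1-hT]^[l+1]) n
        ≈⟨ ⊛-distribʳ-⊕ (negBinomial (suc j)) (negBinomial j) [1-hT]^[l+1] n ⟩
      (negBinomial (suc j) ⊛ [1-hT]^[l+1]) n + (negBinomial j ⊛ [1-hT]^[l+1]) n
        ≈⟨ +-cong (≐-trans (⊛-congˡ (negBinomial (suc j)) [1-hT]^[l+1]≐) (negBinomial-⊛-[1-hT]^[j+1] (suc j)) n)
                  (lower n) ⟩
      const 1# n + 1-hT n
        ≈⟨ 1+[1-hT]≐2-hT n ⟩
      2-hT n
        ∎
      where
      [1-hT]^[l+1]≐ : [1-hT]^[l+1] ≐ 1-hT ⊛ (1-hT ⊛^ suc j)
      [1-hT]^[l+1]≐ = ≐-reflexive (≡.cong (1-hT ⊛^_) (N.+-comm (suc j) 1))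
      lower : negBinomial j ⊛ [1-hT]^[l+1] ≐ 1-hT
      lower = ≐-trans (⊛-congˡ (negBinomial j) (≐-trans [1-hT]^[l+1]≐ (⊛-comm 1-hT (1-hT ⊛^ suc j))))
        (≐-trans (≐-sym (⊛-assoc (negBinomial j) (1-hT ⊛^ suc j) 1-hT))
        (≐-trans (⊛-congʳ 1-hT (negBinomial-⊛-[1-hT]^[j+1] j)) (one-⊛ 1-hT)))
      1+[1-hT]≐2-hT : const 1# ⊕ 1-hT ≐ 2-hT
      1+[1-hT]≐2-hT zero = sym (+-assoc _ _ _)
      1+[1-hT]≐2-hT (suc n) = +-identityˡ _

    bracketTail : PS
    bracketTail = ((T ⊛^ 2) ⊛ 2-hT) ⊘ [1-hT]^[l+1]

    bracketTail≐shiftBy-topTerm : bracketTail ≐ shiftBy 2 topTerm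
    bracketTail≐shiftBy-topTerm =
      ≐-trans (⊛-congʳ (inv [1-hT]^[l+1]) (⊛-congˡ (T ⊛^ 2) (≐-sym topTerm-⊛-[1-hT]^[l+1])))
      (≐-trans (⊛-congʳ (inv [1-hT]^[l+1]) (≐-sym (⊛-assoc (T ⊛^ 2) topTerm [1-hT]^[l+1])))
      (≐-trans (⊛-⊘-cancel ((T ⊛^ 2) ⊛ topTerm) [1-hT]^[l+1] [1-hT]^[l+1]-constantTerm)
      (T^-⊛ 2 topTerm)))

    bracket : PS
    bracket = (const (L h (2 N.* suc j)) ⊕ (const (L h (2 N.* suc j N.+ 1) - h * L h (2 N.* suc j)) ⊛ T))
                ⊖ bracketTail

    tailSeries-zero : tailSeries (suc j) 0 ≈ L h (2 N.* suc j)
    tailSeries-zero = trans (Linc≈lucasSum {suc j} N.≤-refl) (proj₁ (lucasSum-diagonal j))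

    tailSeries-one : tailSeries (suc j) 1 ≈ L h (2 N.* suc j N.+ 1)
    tailSeries-one = trans (Linc≈lucasSum {suc j} (N.n≤1+n _))
      (trans (proj₂ (lucasSum-diagonal j)) (reflexive (≡.cong (L h) (N.+-comm 1 (2 N.* suc j)))))

    tailSeries-⊛-1-hT-T² : tailSeries (suc j) ⊛ 1-hT-T² ≐ bracket
    tailSeries-⊛-1-hT-T² n = begin
      (G ⊛ 1-hT-T²) n                                        ≈⟨ ⊛-comm G 1-hT-T² n ⟩
      (1-hT-T² ⊛ G) n                                        ≈⟨ 1-hT-T²-⊛ G n ⟩
      (G n - h * shift G n) - shift (shift G) n                  ≈⟨ coefficient n ⟩
      (const c₀ n + c₁ * T n) - shiftBy 2 topTerm n
        ≈⟨ +-cong (+-congˡ (const-⊛ c₁ T n)) (-‿cong (bracketTail≐shiftBy-topTerm n)) ⟨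
      bracket n                                                ∎
      where
      G = tailSeries (suc j)
      c₀ = L h (2 N.* suc j)
      c₁ = L h (2 N.* suc j N.+ 1) - h * c₀
      x-0≈x : ∀ x → x - 0# ≈ x
      x-0≈x x = trans (+-congˡ ε⁻¹≈ε) (+-identityʳ x)
      coefficient : ∀ n → (G n - h * shift G n) - shift (shift G) n ≈ (const c₀ n + c₁ * T n) - shiftBy 2 topTerm n
      coefficient zero = begin
        (G 0 - h * 0#) - 0#     ≈⟨ trans (x-0≈x _) (trans (+-congˡ -[h*0]≈0) (+-identityʳ _)) ⟩
        G 0                     ≈⟨ tailSeries-zero ⟩
        c₀                      ≈⟨ trans (+-congˡ (zeroʳ c₁)) (+-identityʳ c₀) ⟨
        c₀ + c₁ * 0#            ≈⟨ x-0≈x _ ⟨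
        (c₀ + c₁ * 0#) - 0#     ∎
      coefficient (suc zero) = begin
        (G 1 - h * G 0) - 0#    ≈⟨ x-0≈x _ ⟩
        G 1 - h * G 0           ≈⟨ +-cong tailSeries-one (-‿cong (*-congˡ tailSeries-zero)) ⟩
        c₁                      ≈⟨ trans (+-identityˡ _) (*-identityʳ c₁) ⟨
        0# + c₁ * 1#            ≈⟨ x-0≈x _ ⟨
        (0# + c₁ * 1#) - 0#     ∎
      coefficient (suc (suc m)) = begin
        (G (suc (suc m)) - h * G (suc m)) - G m   ≈⟨ tailSeries-rec m ⟩
        - topTerm m                             ≈⟨ trans (+-congʳ (trans (+-identityˡ _) (zeroʳ c₁))) (+-identityˡ _) ⟨
        (0# + c₁ * 0#) - topTerm m              ∎

theorem18 : ∀ {c ℓ} (R : CommutativeRing c ℓ) (h : CommutativeRing.Carrier R) (l : ℕ) → 1 N.≤ l →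
  let open CommutativeRing R
      open Lucas R
      H = const h
      two = const (1# + 1#)
      one = const 1#
  in ∀ n → Linc h l n ≈
    (((T ⊛^ (2 N.* l)) ⊛
      (((const (L h (2 N.* l)) ⊕ (const (L h (2 N.* l N.+ 1) - h * L h (2 N.* l)) ⊛ T))
        ⊖ (((T ⊛^ 2) ⊛ (two ⊖ (H ⊛ T))) ⊘ ((one ⊖ (H ⊛ T)) ⊛^ (l N.+ 1))))))
      ⊘ ((one ⊖ (H ⊛ T)) ⊖ (T ⊛^ 2))) n
theorem18 R h (suc j) (s≤s z≤n) n = begin
  Linc h (suc j) n                          ≈⟨ Linc≐shiftBy-tailSeries (suc j) n ⟩
  shiftBy (2 N.* suc j) G n                 ≈⟨ T^-⊛ (2 N.* suc j) G n ⟨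
  (T^2l ⊛ G) n                              ≈⟨ ⊛-congˡ T^2l (⊛-⊘-cancel G 1-hT-T² 1-hT-T²-constantTerm) n ⟨
  (T^2l ⊛ ((G ⊛ 1-hT-T²) ⊘ 1-hT-T²)) n      ≈⟨ ⊛-congˡ T^2l (⊛-congʳ (inv 1-hT-T²) (tailSeries-⊛-1-hT-T² j)) n ⟩
  (T^2l ⊛ (bracket j ⊘ 1-hT-T²)) n          ≈⟨ ⊛-assoc T^2l (bracket j) (inv 1-hT-T²) n ⟨
  ((T^2l ⊛ bracket j) ⊘ 1-hT-T²) n          ∎
  where
  open CommutativeRing R
  open Lucas R
  open PowerSeries R
  open IncompleteLucas R h
  open import Relation.Binary.Reasoning.Setoid setoid
  G = tailSeries (suc j)
  T^2l = T ⊛^ (2 N.* suc j)
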